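{- For any graphs $G$ and $H$, $$\gamma_o(G\Box H)\ge \frac{1}{2}\max\{\gamma(G)\gamma_o(H),\ \gamma_o(G)\gamma(H)\}.$$ Moreover, if $G$ has an efficient dominating set, then $$\gamma_o(G\Box H)\ge \gamma(G)\gamma_o(H).$$
   Context: All graphs are finite and simple. For a graph with vertex set $V$, a vertex $v$ and $S\subseteq V$, let $\delta_S(v)=|N(v)\cap S|$ and $\overline{S}=V\setminus S$. A nonempty set $S\subseteq V$ is a global offensive alliance if $\delta_S(v)\ge \delta_{\overline{S}}(v)+1$ for every $v\in\overline{S}$; $\gamma_o(G)$ is the minimum cardinality of a global offensive alliance of $G$. A set $S$ is a dominating set if every vertex not in $S$ has a neighbor in $S$; $\gamma(G)$ is the minimum cardinality of a dominating set. An efficient dominating set of $G$ is a dominating set $\{u_1,\dots,u_{\gamma(G)}\}$ (of cardinality $\gamma(G)$) such that the closed neighborhoods $N[u_i]$, $N[u_j]$ are disjoint for all $i\neq j$. $G\Box H$ is the Cartesian product: vertex set $V(G)\times V(H)$, with $(a,b)\sim(c,d)$ iff ($a=c$ and $b\sim d$ in $H$) or ($a\sim c$ in $G$ and $b=d$). -}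

module Defs where

open import Data.Nat using (ℕ; suc; _*_; _≤_)
open import Data.Bool using (Bool; true; false; _∧_; _∨_)
open import Data.Fin using (Fin; remQuot)
open import Data.Fin.Properties using (_≟_)
open import Data.Fin.Subset using (Subset; _∈_; _∉_; ∁; _∩_; ∣_∣; Nonempty)
open import Data.Vec using (tabulate)
open import Data.Product using (Σ; ∃; _×_; _,_; proj₁; proj₂)
open import Data.Sum using (_⊎_)
open import Relation.Nullary using (¬_; does)
open import Relation.Binary.PropositionalEquality using (_≡_; _≢_)

Graph : ℕ → Set
Graph n = Fin n → Fin n → Bool

IsSimple : ∀ {n} → Graph n → Set
IsSimple {n} G = (∀ u v → G u v ≡ G v u) × (∀ v → G v v ≡ false)

N : ∀ {n} → Graph n → Fin n → Subset n
N G v = tabulate (λ u → G v u)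

δ : ∀ {n} → Graph n → Subset n → Fin n → ℕ
δ G S v = ∣ N G v ∩ S ∣

IsGOA : ∀ {n} → Graph n → Subset n → Set
IsGOA {n} G S = Nonempty S × (∀ v → v ∉ S → suc (δ G (∁ S) v) ≤ δ G S v)

IsGammaO : ∀ {n} → Graph n → ℕ → Set
IsGammaO G k = (∃ λ S → IsGOA G S × ∣ S ∣ ≡ k) × (∀ S → IsGOA G S → k ≤ ∣ S ∣)

IsDominating : ∀ {n} → Graph n → Subset n → Set
IsDominating G S = ∀ v → v ∉ S → ∃ λ u → u ∈ S × G v u ≡ true

IsGamma : ∀ {n} → Graph n → ℕ → Set
IsGamma G k = (∃ λ S → IsDominating G S × ∣ S ∣ ≡ k) × (∀ S → IsDominating G S → k ≤ ∣ S ∣)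

InClosedNbhd : ∀ {n} → Graph n → Fin n → Fin n → Set
InClosedNbhd G u w = (w ≡ u) ⊎ (G u w ≡ true)

HasEfficientDominatingSet : ∀ {n} → Graph n → Set
HasEfficientDominatingSet G =
  ∃ λ S → IsDominating G S
        × (∀ k → IsGamma G k → ∣ S ∣ ≡ k)
        × (∀ u v → u ∈ S → v ∈ S → u ≢ v →
             ¬ (∃ λ w → InClosedNbhd G u w × InClosedNbhd G v w))

-- Cartesian product G □ H on Fin (m * n); vertex x corresponds to the pair remQuot n x
-- (inverse of Data.Fin.combine).
_□_ : ∀ {m n} → Graph m → Graph n → Graph (m * n)
_□_ {m} {n} G H x y with remQuot {m} n x | remQuot {m} n y
... | a , b | c , d = (does (a ≟ c) ∧ H b d) ∨ (G a c ∧ does (b ≟ d))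

-- Fix a minimum dominating set D of G and give every vertex v of G an owner in D: v itself
-- if v ∈ D, otherwise a neighbour in D. The owners split V(G) into cells. Let S be a global
-- offensive alliance of G □ H, with columns S_h = {g | (g , h) ∈ S}. The shadow of u ∈ D is
-- the set of h such that S_h meets the cell of u, or every vertex of that cell has a
-- neighbour in S_h ("covered"). Each shadow is a global offensive alliance of H: for h
-- outside it some g in the cell has (g , h) ∉ S and no neighbour in S_h, so the alliance
-- inequality of G □ H at (g , h) only involves the H-fibre through g, whose part in S lies
-- in the shadow. Hence γ(G) γₒ(H) ≤ Σ_u |shadow u| = Σ_h #{u | h ∈ shadow u}. For each h
-- at most |S_h| cells meet S_h, and at most |S_h| cells are covered, because removing the
-- covered ones from D and adding S_h leaves a dominating set; this gives the factor 2.
-- Exchanging the roles of G and H gives the bound for γₒ(G) γ(H).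
-- If D is efficient, every neighbour of u ∈ D lies in the cell of u, so covered cells meet
-- S_h and the factor 2 disappears.

module Submission where

open import Defs
open import Data.Nat using (ℕ; zero; suc; _+_; _*_; _≤_; _<_; _⊔_; z≤n; s≤s)
open import Data.Nat.Properties
  using ( n≮0; ≤-refl; ≤-trans; ≤-reflexive; m≤m+n; m≤n+m; +-mono-≤; +-cancelʳ-≤
        ; +-assoc; +-comm; +-identityʳ; *-comm; ⊔-lub; +-*-semiring; module ≤-Reasoning)
open import Data.Bool using (Bool; true; false; _∧_; _∨_; not)
open import Data.Bool.Properties renaming (_≟_ to _≟ᵇ_)
  using ( not-injective; ¬-not; ∨-conicalˡ; ∨-conicalʳ; ∨-zeroʳ
        ; ∧-assoc; ∧-comm; ∧-identityʳ; ∧-zeroʳ; ∧-distribʳ-∨)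
open import Data.Fin using (Fin; zero; suc; combine; _↑ˡ_; _↑ʳ_)
open import Data.Fin.Properties using (_≟_; remQuot-combine; any?; all?; ¬∀⟶∃¬)
open import Data.Fin.Subset using (Subset; _∉_; ∁; _∩_; ∣_∣; Nonempty)
open import Data.Vec using ([]; _∷_; lookup; tabulate)
open import Data.Vec.Properties
  using (lookup∘tabulate; lookup-zipWith; lookup-map; []=⇒lookup; lookup⇒[]=)
open import Data.Product using (∃; _×_; _,_; proj₁; proj₂)
open import Data.Sum using (_⊎_; inj₁; inj₂)
open import Data.Empty using (⊥-elim)
open import Function using (_∘_; flip)
open import Level using (0ℓ)
open import Relation.Nullary using (¬_; Dec; yes; no; does; _×-dec_)
open import Relation.Nullary.Decidable using (dec-true)
open import Relation.Unary using (Pred; Decidable)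
open import Relation.Binary.PropositionalEquality

open import Algebra.Properties.Semiring.Sum +-*-semiring
  using (sum; sum-syntax; sum-cong-≗; ∑-comm; ∑-distrib-+; *-distribʳ-sum; sum-replicate-zero)

∨-∧-introˡ : ∀ x y z → x ∧ z ≡ true → (x ∨ y) ∧ z ≡ true
∨-∧-introˡ true y true refl = refl

∨-∧-introʳ : ∀ x y z → y ∧ z ≡ true → (x ∨ y) ∧ z ≡ true
∨-∧-introʳ x true true refl rewrite ∨-zeroʳ x = refl

∧≡true⇒ : ∀ x y → x ∧ y ≡ true → x ≡ true × y ≡ true
∧≡true⇒ true true refl = refl , refl

∧-monoʳ-true : ∀ x {y z} → (y ≡ true → z ≡ true) → x ∧ y ≡ true → x ∧ z ≡ true
∧-monoʳ-true true y⇒z = y⇒z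

not-antitone : ∀ {y z} → (y ≡ true → z ≡ true) → not z ≡ true → not y ≡ true
not-antitone {false} _   _   = refl
not-antitone {true}  y⇒z ¬z = trans (cong not (sym (y⇒z refl))) ¬z

does≡false⇒¬ : ∀ {A : Set} (a? : Dec A) → does a? ≡ false → ¬ A
does≡false⇒¬ (no ¬a) _ = ¬a

does≡true⇒ : ∀ {A : Set} (a? : Dec A) → does a? ≡ true → A
does≡true⇒ (yes a) _ = a

-- Counting over Fin n

⟦_⟧ : Bool → ℕ
⟦ true ⟧  = 1
⟦ false ⟧ = 0

count : ∀ {n} → (Fin n → Bool) → ℕ
count {n} P = ∑[ i < n ] ⟦ P i ⟧

∑-mono-≤ : ∀ {n} {f g : Fin n → ℕ} → (∀ i → f i ≤ g i) → sum f ≤ sum g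
∑-mono-≤ {zero}  f≤g = z≤n
∑-mono-≤ {suc n} f≤g = +-mono-≤ (f≤g zero) (∑-mono-≤ (f≤g ∘ suc))

term≤∑ : ∀ {n} (f : Fin n → ℕ) i → f i ≤ sum f
term≤∑ f zero    = m≤m+n (f zero) _
term≤∑ f (suc i) = ≤-trans (term≤∑ (f ∘ suc) i) (m≤n+m _ (f zero))

∑-++ : ∀ {m n} (f : Fin (m + n) → ℕ) → sum f ≡ ∑[ i < m ] f (i ↑ˡ n) + ∑[ j < n ] f (m ↑ʳ j)
∑-++ {zero}  f = refl
∑-++ {suc m} {n} f = trans (cong (f zero +_) (∑-++ {m} {n} (f ∘ suc))) (sym (+-assoc (f zero) _ _))

∑-combine : ∀ {m n} (f : Fin (m * n) → ℕ) → sum f ≡ ∑[ a < m ] ∑[ b < n ] f (combine a b)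
∑-combine {zero}      f = refl
∑-combine {suc m} {n} f =
  trans (∑-++ {n} {m * n} f) (cong (sum (f ∘ (_↑ˡ m * n)) +_) (∑-combine {m} {n} (f ∘ (n ↑ʳ_))))

⟦⟧-mono : ∀ {x y} → (x ≡ true → y ≡ true) → ⟦ x ⟧ ≤ ⟦ y ⟧
⟦⟧-mono {false} _   = z≤n
⟦⟧-mono {true}  x⇒y rewrite x⇒y refl = ≤-refl

⟦x∨y⟧≤⟦x⟧+⟦y⟧ : ∀ x y → ⟦ x ∨ y ⟧ ≤ ⟦ x ⟧ + ⟦ y ⟧
⟦x∨y⟧≤⟦x⟧+⟦y⟧ true  y = s≤s z≤n
⟦x∨y⟧≤⟦x⟧+⟦y⟧ false y = ≤-refl

⟦x⟧≡⟦x∧¬y⟧+⟦x∧y⟧ : ∀ x y → ⟦ x ⟧ ≡ ⟦ x ∧ not y ⟧ + ⟦ x ∧ y ⟧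
⟦x⟧≡⟦x∧¬y⟧+⟦x∧y⟧ true  true  = refl
⟦x⟧≡⟦x∧¬y⟧+⟦x∧y⟧ true  false = refl
⟦x⟧≡⟦x∧¬y⟧+⟦x∧y⟧ false y     = refl

module _ {n : ℕ} where

  count-cong : ∀ {P Q : Fin n → Bool} → (∀ i → P i ≡ Q i) → count P ≡ count Q
  count-cong P≗Q = sum-cong-≗ (cong ⟦_⟧ ∘ P≗Q)

  count-false : ∀ {P : Fin n → Bool} → (∀ i → P i ≡ false) → count P ≡ 0
  count-false P≗false = trans (count-cong P≗false) (sum-replicate-zero n)

  count-mono : ∀ {P Q : Fin n → Bool} → (∀ i → P i ≡ true → Q i ≡ true) → count P ≤ count Q
  count-mono P⊆Q = ∑-mono-≤ (λ i → ⟦⟧-mono (P⊆Q i))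

  count-∨ : ∀ (P Q : Fin n → Bool) → count (λ i → P i ∨ Q i) ≤ count P + count Q
  count-∨ P Q = ≤-trans (∑-mono-≤ (λ i → ⟦x∨y⟧≤⟦x⟧+⟦y⟧ (P i) (Q i)))
                        (≤-reflexive (∑-distrib-+ (λ i → ⟦ P i ⟧) (λ i → ⟦ Q i ⟧)))

  count-split : ∀ (P Q : Fin n → Bool) →
                count P ≡ count (λ i → P i ∧ not (Q i)) + count (λ i → P i ∧ Q i)
  count-split P Q = trans (sum-cong-≗ (λ i → ⟦x⟧≡⟦x∧¬y⟧+⟦x∧y⟧ (P i) (Q i)))
                          (∑-distrib-+ (λ i → ⟦ P i ∧ not (Q i) ⟧) (λ i → ⟦ P i ∧ Q i ⟧))

  count*≤∑ : ∀ (P : Fin n → Bool) {c} (f : Fin n → ℕ) → (∀ i → P i ≡ true → c ≤ f i) →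
             count P * c ≤ sum f
  count*≤∑ P {c} f bound = begin
    count P * c               ≡⟨ *-distribʳ-sum c (λ i → ⟦ P i ⟧) ⟩
    ∑[ i < n ] (⟦ P i ⟧ * c)  ≤⟨ ∑-mono-≤ term ⟩
    sum f                     ∎
    where
    open ≤-Reasoning
    term : ∀ i → ⟦ P i ⟧ * c ≤ f i
    term i with P i in Pi
    ... | true  = ≤-trans (≤-reflexive (+-identityʳ c)) (bound i Pi)
    ... | false = z≤n

count-≟∧ : ∀ {n} (v : Fin n) (P : Fin n → Bool) → count (λ u → does (v ≟ u) ∧ P u) ≡ ⟦ P v ⟧
count-≟∧ {suc n} zero    P = trans (cong (⟦ P zero ⟧ +_) (sum-replicate-zero n)) (+-identityʳ _)
count-≟∧ {suc n} (suc v) P = count-≟∧ v (P ∘ suc)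

⟦any?⟧≤count : ∀ {n} {P : Pred (Fin n) 0ℓ} (P? : Decidable P) →
               ⟦ does (any? P?) ⟧ ≤ count (λ i → does (P? i))
⟦any?⟧≤count P? with any? P?
... | yes (i , Pi) = ≤-trans (≤-reflexive (cong ⟦_⟧ (sym (dec-true (P? i) Pi)))) (term≤∑ _ i)
... | no _          = z≤n

module _ {m k} (f : Fin m → Fin k) (C : Fin m → Bool) where

  image? : ∀ u → Dec (∃ λ g → f g ≡ u × C g ≡ true)
  image? u = any? λ g → f g ≟ u ×-dec C g ≟ᵇ true

  image : Fin k → Bool
  image u = does (image? u)

  image-intro : ∀ {g} → C g ≡ true → image (f g) ≡ true
  image-intro {g} Cg = dec-true (image? (f g)) (g , refl , Cg)

  image≡false : ∀ {u g} → image u ≡ false → f g ≡ u → C g ≡ false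
  image≡false {u} {g} u∉image fg≡u = ¬-not λ Cg → does≡false⇒¬ (image? u) u∉image (g , fg≡u , Cg)

  count-image≤count : count image ≤ count C
  count-image≤count = begin
    count image
      ≤⟨ ∑-mono-≤ (λ u → ⟦any?⟧≤count λ g → f g ≟ u ×-dec C g ≟ᵇ true) ⟩
    ∑[ u < k ] ∑[ g < m ] ⟦ does (f g ≟ u) ∧ does (C g ≟ᵇ true) ⟧
      ≡⟨ ∑-comm (λ u g → ⟦ does (f g ≟ u) ∧ does (C g ≟ᵇ true) ⟧) ⟩
    ∑[ g < m ] count (λ u → does (f g ≟ u) ∧ does (C g ≟ᵇ true))
      ≡⟨ sum-cong-≗ (λ g → count-≟∧ (f g) (λ _ → does (C g ≟ᵇ true))) ⟩
    count (λ g → does (C g ≟ᵇ true))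
      ≡⟨ count-cong (λ g → does-≟true (C g)) ⟩
    count C ∎
    where
    open ≤-Reasoning
    does-≟true : ∀ b → does (b ≟ᵇ true) ≡ b
    does-≟true true  = refl
    does-≟true false = refl

-- Subsets as Boolean predicates

∣∣≡count : ∀ {n} (V : Subset n) → ∣ V ∣ ≡ count (lookup V)
∣∣≡count []          = refl
∣∣≡count (true ∷ V)  = cong suc (∣∣≡count V)
∣∣≡count (false ∷ V) = ∣∣≡count V

count-lookup≡ : ∀ {n k} (V : Subset n) → ∣ V ∣ ≡ k → count (lookup V) ≡ k
count-lookup≡ V = trans (sym (∣∣≡count V))

∣tabulate∣≡count : ∀ {n} (P : Fin n → Bool) → ∣ tabulate P ∣ ≡ count P
∣tabulate∣≡count P = trans (∣∣≡count (tabulate P)) (count-cong (lookup∘tabulate P))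

IsDominatingᵇ : ∀ {n} → Graph n → (Fin n → Bool) → Set
IsDominatingᵇ G D = ∀ v → D v ≡ false → ∃ λ u → D u ≡ true × G v u ≡ true

Offensiveᵇ : ∀ {n} → Graph n → (Fin n → Bool) → Set
Offensiveᵇ H B = ∀ h → B h ≡ false →
  suc (count (λ b → H h b ∧ not (B b))) ≤ count (λ b → H h b ∧ B b)

IsGOAᵇ : ∀ {n} → Graph n → (Fin n → Bool) → Set
IsGOAᵇ H B = (∃ λ h → B h ≡ true) × Offensiveᵇ H B

offensive⇒nonempty : ∀ {n} (H : Graph n) {B : Fin n → Bool} → Fin n → Offensiveᵇ H B →
                     ∃ λ h → B h ≡ true
offensive⇒nonempty H {B} h₀ offensive with any? (λ h → B h ≟ᵇ true)
... | yes nonempty = nonempty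
... | no  empty    = ⊥-elim (n≮0 (subst (count (λ b → H h₀ b ∧ not (B b)) <_)
                                        (count-false no-neighbour) (offensive h₀ (B≡false h₀))))
  where
  B≡false : ∀ h → B h ≡ false
  B≡false h = ¬-not λ Bh → empty (h , Bh)
  no-neighbour : ∀ b → H h₀ b ∧ B b ≡ false
  no-neighbour b = trans (cong (H h₀ b ∧_) (B≡false b)) (∧-zeroʳ (H h₀ b))

∉⇒lookup≡false : ∀ {n} (V : Subset n) {x} → x ∉ V → lookup V x ≡ false
∉⇒lookup≡false V {x} x∉V with lookup V x in Vx
... | true  = ⊥-elim (x∉V (lookup⇒[]= x V Vx))
... | false = refl

lookup≡false⇒∉ : ∀ {n} (V : Subset n) {x} → lookup V x ≡ false → x ∉ V
lookup≡false⇒∉ V Vx≡false x∈V with trans (sym ([]=⇒lookup x∈V)) Vx≡false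
... | ()

δ≡count : ∀ {n} (G : Graph n) (V : Subset n) v → δ G V v ≡ count (λ u → G v u ∧ lookup V u)
δ≡count G V v = trans (∣∣≡count (N G v ∩ V)) (count-cong λ u →
  trans (lookup-zipWith _∧_ u (tabulate (G v)) V) (cong (_∧ lookup V u) (lookup∘tabulate (G v) u)))

module _ {n} (G : Graph n) where

  IsDominating⇒ᵇ : ∀ {V} → IsDominating G V → IsDominatingᵇ G (lookup V)
  IsDominating⇒ᵇ {V} dom v Vv≡false with dom v (lookup≡false⇒∉ V Vv≡false)
  ... | u , u∈V , Gvu = u , []=⇒lookup u∈V , Gvu

  dominating-lower-boundᵇ : ∀ {k} → (∀ V → IsDominating G V → k ≤ ∣ V ∣) →
             ∀ D → IsDominatingᵇ G D → k ≤ count D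
  dominating-lower-boundᵇ {k} minimal D dom =
    subst (k ≤_) (∣tabulate∣≡count D) (minimal (tabulate D) dom′)
    where
    dom′ : IsDominating G (tabulate D)
    dom′ v v∉D with dom v (trans (sym (lookup∘tabulate D v)) (∉⇒lookup≡false _ v∉D))
    ... | u , Du , Gvu = u , lookup⇒[]= u _ (trans (lookup∘tabulate D u) Du) , Gvu

  GOA-lower-boundᵇ : ∀ {k} → (∀ S → IsGOA G S → k ≤ ∣ S ∣) → ∀ B → IsGOAᵇ G B → k ≤ count B
  GOA-lower-boundᵇ {k} minimal B ((h , Bh) , offensive) =
    subst (k ≤_) (∣tabulate∣≡count B) (minimal (tabulate B) (nonempty , offensive′))
    where
    nonempty : Nonempty (tabulate B)
    nonempty = h , lookup⇒[]= h _ (trans (lookup∘tabulate B h) Bh)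
    offensive′ : ∀ v → v ∉ tabulate B → suc (δ G (∁ (tabulate B)) v) ≤ δ G (tabulate B) v
    offensive′ v v∉B = subst₂ (λ x y → suc x ≤ y) (sym δ∁≡) (sym δ≡)
      (offensive v (trans (sym (lookup∘tabulate B v)) (∉⇒lookup≡false _ v∉B)))
      where
      δ≡ : δ G (tabulate B) v ≡ count (λ u → G v u ∧ B u)
      δ≡ = trans (δ≡count G _ v) (count-cong λ u → cong (G v u ∧_) (lookup∘tabulate B u))
      δ∁≡ : δ G (∁ (tabulate B)) v ≡ count (λ u → G v u ∧ not (B u))
      δ∁≡ = trans (δ≡count G _ v) (count-cong λ u → cong (G v u ∧_)
              (trans (lookup-map u not (tabulate B)) (cong not (lookup∘tabulate B u))))

-- Neighbourhoods in G □ H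

matrix : ∀ {m n} → Subset (m * n) → Fin m → Fin n → Bool
matrix V a b = lookup V (combine a b)

module _ {m n} (G : Graph m) (H : Graph n) where

  □-combine : ∀ g h a b → (G □ H) (combine g h) (combine a b) ≡
              (does (g ≟ a) ∧ H h b) ∨ (G g a ∧ does (h ≟ b))
  □-combine g h a b = cong₂ adjacent (remQuot-combine {m} {n} g h) (remQuot-combine {m} {n} a b)
    where
    adjacent : Fin m × Fin n → Fin m × Fin n → Bool
    adjacent (g , h) (a , b) = (does (g ≟ a) ∧ H h b) ∨ (G g a ∧ does (h ≟ b))

  module _ (V : Subset (m * n)) (g : Fin m) (h : Fin n) where
    private
      H-edge G-edge H-edge-to-V G-edge-to-V : Fin m → Fin n → Bool
      H-edge a b = does (g ≟ a) ∧ H h b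
      G-edge a b = G g a ∧ does (h ≟ b)
      H-edge-to-V a b = H-edge a b ∧ matrix V a b
      G-edge-to-V a b = G-edge a b ∧ matrix V a b

      edge-to-V : Fin m → Fin n → Bool
      edge-to-V a b = (H-edge a b ∨ G-edge a b) ∧ matrix V a b

      δ-□≡∑ : δ (G □ H) V (combine g h) ≡ ∑[ a < m ] count (edge-to-V a)
      δ-□≡∑ = trans (δ≡count (G □ H) V _) (trans (∑-combine {m} {n} _)
                (sum-cong-≗ λ a → count-cong λ b → cong (_∧ matrix V a b) (□-combine g h a b)))

    H-fibre≤δ-□ : count (λ b → H h b ∧ matrix V g b) ≤ δ (G □ H) V (combine g h)
    H-fibre≤δ-□ = begin
      count (λ b → H h b ∧ matrix V g b)  ≤⟨ count-mono fibre⊆ ⟩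
      count (edge-to-V g)                 ≤⟨ term≤∑ (count ∘ edge-to-V) g ⟩
      ∑[ a < m ] count (edge-to-V a)      ≡⟨ δ-□≡∑ ⟨
      δ (G □ H) V (combine g h)           ∎
      where
      open ≤-Reasoning
      fibre⊆ : ∀ b → H h b ∧ matrix V g b ≡ true → edge-to-V g b ≡ true
      fibre⊆ b e rewrite dec-true (g ≟ g) refl = ∨-∧-introˡ (H h b) (G-edge g b) (matrix V g b) e

    G-fibre≤δ-□ : count (λ a → G g a ∧ matrix V a h) ≤ δ (G □ H) V (combine g h)
    G-fibre≤δ-□ = begin
      count (λ a → G g a ∧ matrix V a h)  ≤⟨ ∑-mono-≤ (λ a → ≤-trans (⟦⟧-mono (fibre⊆ a))
                                                                     (term≤∑ (⟦_⟧ ∘ edge-to-V a) h)) ⟩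
      ∑[ a < m ] count (edge-to-V a)      ≡⟨ δ-□≡∑ ⟨
      δ (G □ H) V (combine g h)           ∎
      where
      open ≤-Reasoning
      fibre⊆ : ∀ a → G g a ∧ matrix V a h ≡ true → edge-to-V a h ≡ true
      fibre⊆ a e rewrite dec-true (h ≟ h) refl | ∧-identityʳ (G g a) =
        ∨-∧-introʳ (H-edge a h) (G g a) (matrix V a h) e

    δ-□≤fibres : δ (G □ H) V (combine g h) ≤
                 count (λ b → H h b ∧ matrix V g b) + count (λ a → G g a ∧ matrix V a h)
    δ-□≤fibres = begin
      δ (G □ H) V (combine g h)
        ≡⟨ δ-□≡∑ ⟩
      ∑[ a < m ] count (edge-to-V a)
        ≡⟨ sum-cong-≗ (λ a → count-cong λ b → ∧-distribʳ-∨ (matrix V a b) (H-edge a b) (G-edge a b)) ⟩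
      ∑[ a < m ] count (λ b → H-edge-to-V a b ∨ G-edge-to-V a b)
        ≤⟨ ∑-mono-≤ (λ a → count-∨ (H-edge-to-V a) (G-edge-to-V a)) ⟩
      ∑[ a < m ] (count (H-edge-to-V a) + count (G-edge-to-V a))
        ≡⟨ ∑-distrib-+ (count ∘ H-edge-to-V) (count ∘ G-edge-to-V) ⟩
      ∑[ a < m ] count (H-edge-to-V a) + ∑[ a < m ] count (G-edge-to-V a)
        ≡⟨ cong₂ _+_ H-part G-part ⟩
      count (λ b → H h b ∧ matrix V g b) + count (λ a → G g a ∧ matrix V a h) ∎
      where
      open ≤-Reasoning
      H-part : ∑[ a < m ] count (H-edge-to-V a) ≡ count (λ b → H h b ∧ matrix V g b)
      H-part = begin-equality
        ∑[ a < m ] count (H-edge-to-V a)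
          ≡⟨ sum-cong-≗ (λ a → count-cong λ b → ∧-assoc (does (g ≟ a)) (H h b) (matrix V a b)) ⟩
        ∑[ a < m ] ∑[ b < n ] ⟦ does (g ≟ a) ∧ (H h b ∧ matrix V a b) ⟧
          ≡⟨ ∑-comm (λ a b → ⟦ does (g ≟ a) ∧ (H h b ∧ matrix V a b) ⟧) ⟩
        ∑[ b < n ] count (λ a → does (g ≟ a) ∧ (H h b ∧ matrix V a b))
          ≡⟨ sum-cong-≗ (λ b → count-≟∧ g (λ a → H h b ∧ matrix V a b)) ⟩
        count (λ b → H h b ∧ matrix V g b) ∎
      G-part : ∑[ a < m ] count (G-edge-to-V a) ≡ count (λ a → G g a ∧ matrix V a h)
      G-part = sum-cong-≗ λ a → trans
        (count-cong λ b → trans (cong (_∧ matrix V a b) (∧-comm (G g a) (does (h ≟ b))))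
                                (∧-assoc (does (h ≟ b)) (G g a) (matrix V a b)))
        (count-≟∧ h (λ b → G g a ∧ matrix V a b))

FibreOffensive : ∀ {m n} → Graph m → Graph n → (Fin m → Fin n → Bool) → Set
FibreOffensive G H S = ∀ g h → S g h ≡ false → (∀ a → G g a ∧ S a h ≡ false) →
  suc (count (λ b → H h b ∧ not (S g b))) ≤ count (λ b → H h b ∧ S g b)

module _ {m n} (G : Graph m) (H : Graph n) (T : Subset (m * n)) (T-goa : IsGOA (G □ H) T) where
  private
    S : Fin m → Fin n → Bool
    S = matrix T

    offensive-at : ∀ g h → S g h ≡ false →
                   suc (δ (G □ H) (∁ T) (combine g h)) ≤ δ (G □ H) T (combine g h)
    offensive-at g h Sgh = proj₂ T-goa (combine g h) (lookup≡false⇒∉ T Sgh)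

    matrix-∁ : ∀ a b → matrix (∁ T) a b ≡ not (S a b)
    matrix-∁ a b = lookup-map (combine a b) not T

  IsGOA-□⇒FibreOffensive : FibreOffensive G H (matrix {m} T)
  IsGOA-□⇒FibreOffensive g h Sgh G-fibre-misses = begin-strict
    count (λ b → H h b ∧ not (S g b))
      ≡⟨ count-cong (λ b → cong (H h b ∧_) (matrix-∁ g b)) ⟨
    count (λ b → H h b ∧ matrix (∁ T) g b)
      ≤⟨ H-fibre≤δ-□ G H (∁ T) g h ⟩
    δ (G □ H) (∁ T) (combine g h)
      <⟨ offensive-at g h Sgh ⟩
    δ (G □ H) T (combine g h)
      ≤⟨ δ-□≤fibres G H T g h ⟩
    count (λ b → H h b ∧ S g b) + count (λ a → G g a ∧ S a h)
      ≡⟨ cong (count (λ b → H h b ∧ S g b) +_) (count-false G-fibre-misses) ⟩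
    count (λ b → H h b ∧ S g b) + 0
      ≡⟨ +-identityʳ _ ⟩
    count (λ b → H h b ∧ S g b) ∎
    where open ≤-Reasoning

  IsGOA-□⇒FibreOffensive-transposed : FibreOffensive H G (flip (matrix {m} T))
  IsGOA-□⇒FibreOffensive-transposed h g Sgh H-fibre-misses = begin-strict
    count (λ a → G g a ∧ not (S a h))
      ≡⟨ count-cong (λ a → cong (G g a ∧_) (matrix-∁ a h)) ⟨
    count (λ a → G g a ∧ matrix (∁ T) a h)
      ≤⟨ G-fibre≤δ-□ G H (∁ T) g h ⟩
    δ (G □ H) (∁ T) (combine g h)
      <⟨ offensive-at g h Sgh ⟩
    δ (G □ H) T (combine g h)
      ≤⟨ δ-□≤fibres G H T g h ⟩
    count (λ b → H h b ∧ S g b) + count (λ a → G g a ∧ S a h)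
      ≡⟨ cong (_+ count (λ a → G g a ∧ S a h)) (count-false H-fibre-misses) ⟩
    count (λ a → G g a ∧ S a h) ∎
    where open ≤-Reasoning

  ∣T∣≡∑rows : ∣ T ∣ ≡ ∑[ g < m ] count (matrix {m} T g)
  ∣T∣≡∑rows = trans (∣∣≡count T) (∑-combine {m} {n} (⟦_⟧ ∘ lookup T))

  ∣T∣≡∑columns : ∣ T ∣ ≡ ∑[ h < n ] count (λ g → matrix {m} T g h)
  ∣T∣≡∑columns = trans ∣T∣≡∑rows (∑-comm (λ g h → ⟦ S g h ⟧))

-- Cells of a dominating set

module Cells {m} (G : Graph m) (D : Fin m → Bool) (dominating : IsDominatingᵇ G D) where

  private
    owner-of : ∀ v b → D v ≡ b → Fin m
    owner-of v true  _  = v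
    owner-of v false Dv = proj₁ (dominating v Dv)

    owner-of-∈ : ∀ v b (Dv : D v ≡ b) → D (owner-of v b Dv) ≡ true
    owner-of-∈ v true  Dv = Dv
    owner-of-∈ v false Dv = proj₁ (proj₂ (dominating v Dv))

    owner-of-near : ∀ v b (Dv : D v ≡ b) → v ≡ owner-of v b Dv ⊎ G v (owner-of v b Dv) ≡ true
    owner-of-near v true  _  = inj₁ refl
    owner-of-near v false Dv = inj₂ (proj₂ (proj₂ (dominating v Dv)))

  owner : Fin m → Fin m
  owner v = owner-of v (D v) refl

  owner-∈ : ∀ v → D (owner v) ≡ true
  owner-∈ v = owner-of-∈ v (D v) refl

  owner-near : ∀ v → v ≡ owner v ⊎ G v (owner v) ≡ true
  owner-near v = owner-of-near v (D v) refl

  owner-fixes : ∀ {u} → D u ≡ true → owner u ≡ u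
  owner-fixes {u} Du = fixes (D u) refl Du
    where
    fixes : ∀ b (Du : D u ≡ b) → b ≡ true → owner-of u b Du ≡ u
    fixes true _ _ = refl

  exposed? : ∀ u (C : Fin m → Bool) → Dec (∃ λ g → owner g ≡ u × (∀ g′ → G g g′ ∧ C g′ ≡ false))
  exposed? u C = any? λ g → owner g ≟ u ×-dec all? λ g′ → G g g′ ∧ C g′ ≟ᵇ false

  exposed : Fin m → (Fin m → Bool) → Bool
  exposed u C = does (exposed? u C)

  covered : Fin m → (Fin m → Bool) → Bool
  covered u C = D u ∧ not (exposed u C)

  unexposed⇒neighbour : ∀ {C} v → exposed (owner v) C ≡ false →
                        ∃ λ g′ → G v g′ ≡ true × C g′ ≡ true
  unexposed⇒neighbour {C} v unexposed
    with ¬∀⟶∃¬ m (λ g′ → G v g′ ∧ C g′ ≡ false) (λ g′ → G v g′ ∧ C g′ ≟ᵇ false)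
           (λ isolated → does≡false⇒¬ (exposed? (owner v) C) unexposed (v , refl , isolated))
  ... | g′ , has-neighbour = g′ , ∧≡true⇒ (G v g′) (C g′) (¬-not has-neighbour)

  count-covered≤count : ∀ {k} → count D ≡ k → (∀ D′ → IsDominatingᵇ G D′ → k ≤ count D′) →
                        ∀ C → count (λ u → covered u C) ≤ count C
  count-covered≤count {k} ∣D∣≡k minimal C = +-cancelʳ-≤ _ _ _ (begin
    count (λ u → covered u C) + count uncovered  ≡⟨ count-split D (λ u → exposed u C) ⟨
    count D                                      ≡⟨ ∣D∣≡k ⟩
    k                                            ≤⟨ minimal D′ D′-dominating ⟩
    count D′                                     ≤⟨ count-∨ uncovered C ⟩
    count uncovered + count C                    ≡⟨ +-comm (count uncovered) (count C) ⟩
    count C + count uncovered                    ∎)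
    where
    open ≤-Reasoning
    uncovered D′ : Fin m → Bool
    uncovered u = D u ∧ exposed u C
    D′ v = uncovered v ∨ C v
    D′-dominating : IsDominatingᵇ G D′
    D′-dominating v D′v≡false with exposed (owner v) C in exposed-ov
    ... | false with unexposed⇒neighbour v exposed-ov
    ...   | g′ , Gvg′ , Cg′ = g′ , trans (cong (uncovered g′ ∨_) Cg′) (∨-zeroʳ _) , Gvg′
    D′-dominating v D′v≡false | true =
      owner v , cong (_∨ C (owner v)) uncovered-ov , adjacent
      where
      uncovered-ov : uncovered (owner v) ≡ true
      uncovered-ov = cong₂ _∧_ (owner-∈ v) exposed-ov
      adjacent : G v (owner v) ≡ true
      adjacent with owner-near v
      ... | inj₂ Gv-ov = Gv-ov
      ... | inj₁ v≡ov
        with trans (sym (trans (cong uncovered v≡ov) uncovered-ov)) (∨-conicalˡ _ _ D′v≡false)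
      ...   | ()

  module _ (symmetric : ∀ u v → G u v ≡ G v u)
           (efficient : ∀ u v → D u ≡ true → D v ≡ true → u ≢ v →
                        ¬ (∃ λ w → InClosedNbhd G u w × InClosedNbhd G v w)) where

    owner-of-neighbour : ∀ {u g} → D u ≡ true → G u g ≡ true → owner g ≡ u
    owner-of-neighbour {u} {g} Du Gug with owner g ≟ u
    ... | yes og≡u = og≡u
    ... | no  og≢u =
      ⊥-elim (efficient u (owner g) Du (owner-∈ g) (og≢u ∘ sym) (g , inj₂ Gug , g∈N[og]))
      where
      g∈N[og] : InClosedNbhd G (owner g) g
      g∈N[og] with owner-near g
      ... | inj₁ g≡og  = inj₁ g≡og
      ... | inj₂ Gg-og = inj₂ (trans (symmetric (owner g) g) Gg-og)

    covered⇒image : ∀ {u C} → covered u C ≡ true → image owner C u ≡ true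
    covered⇒image {u} {C} covered-u with ∧≡true⇒ (D u) _ covered-u
    ... | Du , unexposed
      with unexposed⇒neighbour {C} u
             (trans (cong (λ w → exposed w C) (owner-fixes Du)) (not-injective unexposed))
    ...   | g′ , Gug′ , Cg′ =
      subst (λ w → image owner C w ≡ true) (owner-of-neighbour Du Gug′) (image-intro owner C Cg′)

  module _ {n} (H : Graph n) (S : Fin m → Fin n → Bool) where

    column : Fin n → Fin m → Bool
    column h g = S g h

    shadow : Fin m → Fin n → Bool
    shadow u h = image owner (column h) u ∨ covered u (column h)

    shadow≡false⇒exposed : ∀ {u h} → D u ≡ true → shadow u h ≡ false → exposed u (column h) ≡ true
    shadow≡false⇒exposed {u} {h} Du shadow≡false = not-injective
      (trans (sym (cong (λ x → x ∧ not (exposed u (column h))) Du)) (∨-conicalʳ _ _ shadow≡false))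

    shadow-offensive : FibreOffensive G H S → ∀ {u} → D u ≡ true → Offensiveᵇ H (shadow u)
    shadow-offensive offensive {u} Du h shadow≡false
      with does≡true⇒ (exposed? u (column h)) (shadow≡false⇒exposed Du shadow≡false)
    ... | g , og≡u , G-fibre-misses = begin-strict
      count (λ b → H h b ∧ not (shadow u b))
        ≤⟨ count-mono (λ b → ∧-monoʳ-true (H h b) (not-antitone (row⊆shadow b))) ⟩
      count (λ b → H h b ∧ not (S g b))
        <⟨ offensive g h Sgh≡false G-fibre-misses ⟩
      count (λ b → H h b ∧ S g b)
        ≤⟨ count-mono (λ b → ∧-monoʳ-true (H h b) (row⊆shadow b)) ⟩
      count (λ b → H h b ∧ shadow u b) ∎
      where
      open ≤-Reasoning
      Sgh≡false : S g h ≡ false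
      Sgh≡false = image≡false owner (column h) (∨-conicalˡ _ _ shadow≡false) og≡u
      row⊆shadow : ∀ b → S g b ≡ true → shadow u b ≡ true
      row⊆shadow b Sgb = cong (_∨ covered u (column b))
        (subst (λ w → image owner (column b) w ≡ true) og≡u (image-intro owner (column b) Sgb))

    module _ (offensive : FibreOffensive G H S) (h₀ : Fin n) {k γₒ : ℕ} (∣D∣≡k : count D ≡ k)
             (γₒ-minimal : ∀ B → IsGOAᵇ H B → γₒ ≤ count B) where

      k*γₒ≤∑shadows : k * γₒ ≤ ∑[ h < n ] count (λ u → shadow u h)
      k*γₒ≤∑shadows = begin
        k * γₒ                               ≡⟨ cong (_* γₒ) ∣D∣≡k ⟨
        count D * γₒ                         ≤⟨ count*≤∑ D (count ∘ shadow) shadow-large ⟩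
        ∑[ u < m ] count (shadow u)          ≡⟨ ∑-comm (λ u h → ⟦ shadow u h ⟧) ⟩
        ∑[ h < n ] count (λ u → shadow u h)  ∎
        where
        open ≤-Reasoning
        shadow-large : ∀ u → D u ≡ true → γₒ ≤ count (shadow u)
        shadow-large u Du = γₒ-minimal (shadow u)
          (offensive⇒nonempty H h₀ (shadow-offensive offensive Du) , shadow-offensive offensive Du)

      k*γₒ≤2*∑columns : (∀ D′ → IsDominatingᵇ G D′ → k ≤ count D′) →
                         k * γₒ ≤ 2 * ∑[ h < n ] count (column h)
      k*γₒ≤2*∑columns minimal = begin
        k * γₒ
          ≤⟨ k*γₒ≤∑shadows ⟩
        ∑[ h < n ] count (λ u → shadow u h)
          ≤⟨ ∑-mono-≤ column-bound ⟩
        ∑[ h < n ] (count (column h) + count (column h))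
          ≡⟨ ∑-distrib-+ (count ∘ column) (count ∘ column) ⟩
        ∑[ h < n ] count (column h) + ∑[ h < n ] count (column h)
          ≡⟨ cong (∑[ h < n ] count (column h) +_) (+-identityʳ _) ⟨
        2 * ∑[ h < n ] count (column h) ∎
        where
        open ≤-Reasoning
        column-bound : ∀ h → count (λ u → shadow u h) ≤ count (column h) + count (column h)
        column-bound h = ≤-trans (count-∨ (image owner (column h)) (λ u → covered u (column h)))
          (+-mono-≤ (count-image≤count owner (column h)) (count-covered≤count ∣D∣≡k minimal (column h)))

      k*γₒ≤∑columns : (∀ u v → G u v ≡ G v u) →
                      (∀ u v → D u ≡ true → D v ≡ true → u ≢ v →
                         ¬ (∃ λ w → InClosedNbhd G u w × InClosedNbhd G v w)) →
                      k * γₒ ≤ ∑[ h < n ] count (column h)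
      k*γₒ≤∑columns symmetric efficient = begin
        k * γₒ                               ≤⟨ k*γₒ≤∑shadows ⟩
        ∑[ h < n ] count (λ u → shadow u h)  ≤⟨ ∑-mono-≤ column-bound ⟩
        ∑[ h < n ] count (column h)          ∎
        where
        open ≤-Reasoning
        shadow⊆image : ∀ h u → shadow u h ≡ true → image owner (column h) u ≡ true
        shadow⊆image h u with image owner (column h) u in image≡
        ... | true  = λ _ → refl
        ... | false = λ covered-u → trans (sym image≡) (covered⇒image symmetric efficient covered-u)
        column-bound : ∀ h → count (λ u → shadow u h) ≤ count (column h)
        column-bound h = ≤-trans (count-mono (shadow⊆image h)) (count-image≤count owner (column h))

module _ {m n} (G : Graph m) (H : Graph n) (T : Subset (m * n)) (T-goa : IsGOA (G □ H) T) where

  γ*γₒ≤2∣T∣ : ∀ {γ γₒ} → IsGamma G γ → IsGammaO H γₒ → γ * γₒ ≤ 2 * ∣ T ∣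
  γ*γₒ≤2∣T∣ ((D , D-dominating , ∣D∣) , γ-minimal) ((_ , ((h₀ , _) , _) , _) , γₒ-minimal) =
    subst (λ x → _ ≤ 2 * x) (sym (∣T∣≡∑columns G H T T-goa))
      (Cells.k*γₒ≤2*∑columns G (lookup D) (IsDominating⇒ᵇ G D-dominating) H (matrix T)
        (IsGOA-□⇒FibreOffensive G H T T-goa) h₀ (count-lookup≡ D ∣D∣)
        (GOA-lower-boundᵇ H γₒ-minimal) (dominating-lower-boundᵇ G γ-minimal))

  γ*γₒ≤2∣T∣-transposed : ∀ {γ γₒ} → IsGamma H γ → IsGammaO G γₒ → γ * γₒ ≤ 2 * ∣ T ∣
  γ*γₒ≤2∣T∣-transposed ((D , D-dominating , ∣D∣) , γ-minimal) ((_ , ((g₀ , _) , _) , _) , γₒ-minimal) =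
    subst (λ x → _ ≤ 2 * x) (sym (∣T∣≡∑rows G H T T-goa))
      (Cells.k*γₒ≤2*∑columns H (lookup D) (IsDominating⇒ᵇ H D-dominating) G (flip (matrix T))
        (IsGOA-□⇒FibreOffensive-transposed G H T T-goa) g₀ (count-lookup≡ D ∣D∣)
        (GOA-lower-boundᵇ G γₒ-minimal) (dominating-lower-boundᵇ H γ-minimal))

  γ*γₒ≤∣T∣ : ∀ {γ γₒ} → IsSimple G → IsGamma G γ → IsGammaO H γₒ → HasEfficientDominatingSet G →
             γ * γₒ ≤ ∣ T ∣
  γ*γₒ≤∣T∣ (symmetric , _) γ-G ((_ , ((h₀ , _) , _) , _) , γₒ-minimal)
           (E , E-dominating , ∣E∣ , E-efficient) =
    subst (_ ≤_) (sym (∣T∣≡∑columns G H T T-goa))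
      (Cells.k*γₒ≤∑columns G (lookup E) (IsDominating⇒ᵇ G E-dominating) H (matrix T)
        (IsGOA-□⇒FibreOffensive G H T T-goa) h₀ (count-lookup≡ E (∣E∣ _ γ-G))
        (GOA-lower-boundᵇ H γₒ-minimal) symmetric
        (λ u v Eu Ev → E-efficient u v (lookup⇒[]= u E Eu) (lookup⇒[]= v E Ev)))

theorem2 : ∀ {m n} (G : Graph m) (H : Graph n) → IsSimple G → IsSimple H →
    ∀ {gG goG gH goH goGH : ℕ} →
    IsGamma G gG → IsGammaO G goG → IsGamma H gH → IsGammaO H goH →
    IsGammaO (G □ H) goGH →
    ((gG * goH) ⊔ (goG * gH) ≤ 2 * goGH)
    × (HasEfficientDominatingSet G → gG * goH ≤ goGH)
theorem2 G H G-simple _ {goG = goG} {gH} γ-G γₒ-G γ-H γₒ-H ((T , T-goa , refl) , _) =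
  ⊔-lub (γ*γₒ≤2∣T∣ G H T T-goa γ-G γₒ-H)
        (subst (_≤ 2 * ∣ T ∣) (*-comm gH goG) (γ*γₒ≤2∣T∣-transposed G H T T-goa γ-H γₒ-G)) ,
  γ*γₒ≤∣T∣ G H T T-goa G-simple γ-G γₒ-H
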